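{- Let $F_1(a_1,\dots,a_m),\dots,F_k(a_1,\dots,a_m)$ be good polynomials, and suppose the family $\{F_1,\dots,F_k\}$ is partition regular over $T$. Let $R$ be an integral domain of characteristic $0$. Then the family is partition regular over $R$: for every coloring of $R\setminus\{0\}$ with finitely many colors there exist $a_1,\dots,a_m\in R\setminus\{0\}$ such that $F_1(a),\dots,F_k(a)$ are all nonzero and have the same color.
   Context: A polynomial (in one or several variables) is called good if it has nonnegative integer coefficients and zero constant term. $T$ denotes the set of nonzero good polynomials in a single variable $t$, closed under addition and multiplication. The family is partition regular over $T$ if for every coloring of $T$ with finitely many colors there exist $a_1,\dots,a_m\in T$ with $F_1(a),\dots,F_k(a)$ all of the same color. An integral domain $R$ has characteristic $0$ if for every positive integer $k$ there is $x\in R$ with $kx=x+\cdots+x\neq 0$. -}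

module Defs where

open import Level using (Level; _⊔_)
open import Data.Nat using (ℕ; zero; suc; _≤_) renaming (_+_ to _+ℕ_; _*_ to _*ℕ_)
open import Data.Fin using (Fin; zero; suc)
open import Data.List using (List; []; _∷_; foldr; map)
open import Data.List.Relation.Unary.All using (All)
open import Data.Product using (Σ; ∃; _×_; _,_; proj₁; proj₂)
open import Data.Sum using (_⊎_)
open import Relation.Nullary using (¬_)
open import Relation.Binary.PropositionalEquality using (_≡_; _≢_)
open import Algebra.Bundles using (CommutativeRing; Semiring)
open import Algebra.Bundles.Raw using (RawSemiring)

-- A monomial is a pair (coefficient , exponent vector); a polynomial is a
-- finite list of monomials (i.e. their sum).  Coefficients are in ℕ
-- (nonnegative integers); "zero constant term" is enforced by requiring
-- every exponent vector to be nonzero.  Every good polynomial has such a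
-- representation.

Monomial : ℕ → Set
Monomial m = ℕ × (Fin m → ℕ)

record GoodPoly (m : ℕ) : Set where
  field
    monomials    : List (Monomial m)
    noConstTerm  : All (λ mon → ∃ λ i → proj₂ mon i ≢ 0) monomials
open GoodPoly public

module Eval {c ℓ : Level} (S : RawSemiring c ℓ) where
  open RawSemiring S

  _•_ : ℕ → Carrier → Carrier
  zero  • x = 0#
  suc n • x = x + (n • x)

  _^_ : Carrier → ℕ → Carrier
  x ^ zero  = 1#
  x ^ suc n = x * (x ^ n)

  prodFin : (n : ℕ) → (Fin n → Carrier) → Carrier
  prodFin zero    f = 1#
  prodFin (suc n) f = f zero * prodFin n (λ i → f (suc i))

  evalMono : {m : ℕ} → Monomial m → (Fin m → Carrier) → Carrier
  evalMono {m} (k , e) a = k • prodFin m (λ i → a i ^ e i)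

  eval : {m : ℕ} → GoodPoly m → (Fin m → Carrier) → Carrier
  eval F a = foldr (λ mon acc → evalMono mon a + acc) 0# (monomials F)

-- Polynomials in one variable t with ℕ coefficients, as coefficient lists
-- [c₀ , c₁ , c₂ , …] meaning c₀ + c₁ t + c₂ t² + ⋯, kept in canonical form
-- (no trailing zeros), so that _≡_ on lists is equality of polynomials.

addL : List ℕ → List ℕ → List ℕ
addL []       q        = q
addL (x ∷ p)  []       = x ∷ p
addL (x ∷ p)  (y ∷ q)  = (x +ℕ y) ∷ addL p q

mulL : List ℕ → List ℕ → List ℕ
mulL []      q = []
mulL (x ∷ p) q = addL (map (x *ℕ_) q) (0 ∷ mulL p q)

trim : List ℕ → List ℕ
trim []       = []
trim (x ∷ xs) with trim xs
... | []     with x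
...   | zero  = []
...   | suc n = suc n ∷ []
trim (x ∷ xs) | y ∷ ys = x ∷ y ∷ ys

ℕ[t] : RawSemiring Level.zero Level.zero
ℕ[t] = record
  { Carrier = List ℕ
  ; _≈_     = _≡_
  ; _+_     = λ p q → trim (addL p q)
  ; _*_     = λ p q → trim (mulL p q)
  ; 0#      = []
  ; 1#      = 1 ∷ []
  }

-- membership in T: canonical, zero constant term, and nonzero
-- (a canonical list of the form 0 ∷ q is automatically nonzero, since
--  trim (0 ∷ []) = []).
InT : List ℕ → Set
InT p = (∃ λ q → p ≡ 0 ∷ q) × (trim p ≡ p)

evalT : {m : ℕ} → GoodPoly m → (Fin m → List ℕ) → List ℕ
evalT = Eval.eval ℕ[t]

-- partition regularity over T: every finite colouring of T admits
-- a₁,…,a_m ∈ T with all F_j(a) ∈ T and of the same colour.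
-- (A colouring of T is given as a function on all coefficient lists;
--  only its values on T matter, and every colouring of T extends.)
PartitionRegularT : {m k : ℕ} → (Fin k → GoodPoly m) → Set
PartitionRegularT {m} {k} F =
  (r : ℕ) (col : List ℕ → Fin r) →
  Σ (Fin m → List ℕ) λ a →
    (∀ i → InT (a i)) ×
    (∀ j → InT (evalT (F j) a)) ×
    (∀ j j′ → col (evalT (F j) a) ≡ col (evalT (F j′) a))

module _ {c ℓ : Level} (R : CommutativeRing c ℓ) where
  open CommutativeRing R
  rawSR : RawSemiring c ℓ
  rawSR = Semiring.rawSemiring semiring
  open Eval rawSR using (_•_)

  record IsIntegralDomain : Set (c ⊔ ℓ) where
    field
      nontrivial    : ¬ (1# ≈ 0#)
      noZeroDivisor : ∀ x y → x * y ≈ 0# → x ≈ 0# ⊎ y ≈ 0#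

  CharacteristicZero : Set (c ⊔ ℓ)
  CharacteristicZero = ∀ (k : ℕ) → 1 ≤ k → ∃ λ x → ¬ (k • x ≈ 0#)

  -- partition regularity over R: every finite colouring of R ∖ {0}
  -- (given as a ≈-respecting function on R; its value at 0 is irrelevant)
  -- admits nonzero a₁,…,a_m with all F_j(a) nonzero and of the same colour.
  PartitionRegularR : {m k : ℕ} → (Fin k → GoodPoly m) → Set (c ⊔ ℓ)
  PartitionRegularR {m} {k} F =
    (r : ℕ) (col : Carrier → Fin r) →
    (∀ x y → x ≈ y → col x ≡ col y) →
    Σ (Fin m → Carrier) λ a →
      (∀ i → ¬ (a i ≈ 0#)) ×
      (∀ j → ¬ (Eval.eval rawSR (F j) a ≈ 0#)) ×
      (∀ j j′ → col (Eval.eval rawSR (F j) a) ≡ col (Eval.eval rawSR (F j′) a))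

-- Evaluating at t = 1 and then applying the canonical map ℕ → R, n ↦ n · 1, is a
-- semiring homomorphism ℕ[t] → R, so it commutes with every good polynomial.  An
-- element of T has a positive coefficient, hence a positive value at t = 1, and in
-- characteristic 0 the canonical map sends positive integers to nonzero elements.
-- Pulling a colouring of R back along this homomorphism and applying partition
-- regularity over T therefore gives a monochromatic solution in R.
module Submission where

open import Defs
open import Level using (Level)
open import Function.Base using (_∘_)
open import Data.Nat.Base using (ℕ; zero; suc; s≤s; z≤n; NonZero; +-*-rawSemiring)
open import Data.Nat.Properties
  using (+-identityʳ; *-zeroʳ; *-distribˡ-+; *-distribʳ-+; +-commutativeSemigroup)
open import Data.Nat.ListAction using (sum)
open import Data.Fin.Base as Fin using (Fin)
open import Data.List.Base using (List; []; _∷_; foldr; map)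
open import Data.Product.Base using (_,_)
open import Relation.Nullary.Negation using (¬_)
open import Relation.Binary.PropositionalEquality as ≡ using (_≡_; module ≡-Reasoning)
open import Algebra.Bundles using (CommutativeRing; Semiring)
open import Algebra.Bundles.Raw using (RawSemiring)
open import Algebra.Morphism.Structures using (IsSemiringHomomorphism)
import Algebra.Morphism.Construct.Composition as Composition
open import Algebra.Properties.CommutativeSemigroup +-commutativeSemigroup using (interchange)

module EvaluationAtOne where
  open import Data.Nat.Base using (_+_; _*_)

  sum-trim : ∀ p → sum (trim p) ≡ sum p
  sum-trim [] = ≡.refl
  sum-trim (x ∷ p) with trim p | sum-trim p
  ... | []    | eq with x
  ...   | zero  = eq
  ...   | suc n = ≡.cong (λ s → suc (n + s)) eq
  sum-trim (x ∷ p) | y ∷ q | eq = ≡.cong (x +_) eq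

  sum≡0⇒trim≡[] : ∀ p → sum p ≡ 0 → trim p ≡ []
  sum≡0⇒trim≡[] []          _  = ≡.refl
  sum≡0⇒trim≡[] (zero ∷ p)  eq rewrite sum≡0⇒trim≡[] p eq = ≡.refl

  sum-addL : ∀ p q → sum (addL p q) ≡ sum p + sum q
  sum-addL []      q       = ≡.refl
  sum-addL (x ∷ p) []      = ≡.sym (+-identityʳ _)
  sum-addL (x ∷ p) (y ∷ q) = begin
    x + y + sum (addL p q)     ≡⟨ ≡.cong (x + y +_) (sum-addL p q) ⟩
    x + y + (sum p + sum q)    ≡⟨ interchange x y (sum p) (sum q) ⟩
    x + sum p + (y + sum q)    ∎
    where open ≡-Reasoning

  sum-map-* : ∀ n p → sum (map (n *_) p) ≡ n * sum p
  sum-map-* n []      = ≡.sym (*-zeroʳ n)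
  sum-map-* n (x ∷ p) = ≡.trans (≡.cong (n * x +_) (sum-map-* n p)) (≡.sym (*-distribˡ-+ n x (sum p)))

  sum-mulL : ∀ p q → sum (mulL p q) ≡ sum p * sum q
  sum-mulL []      q = ≡.refl
  sum-mulL (x ∷ p) q = begin
    sum (addL (map (x *_) q) (0 ∷ mulL p q))   ≡⟨ sum-addL (map (x *_) q) (0 ∷ mulL p q) ⟩
    sum (map (x *_) q) + sum (mulL p q)        ≡⟨ ≡.cong (_+ sum (mulL p q)) (sum-map-* x q) ⟩
    x * sum q + sum (mulL p q)                 ≡⟨ ≡.cong (x * sum q +_) (sum-mulL p q) ⟩
    x * sum q + sum p * sum q                  ≡⟨ ≡.sym (*-distribʳ-+ (sum q) x (sum p)) ⟩
    (x + sum p) * sum q                        ∎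
    where open ≡-Reasoning

  sum-isSemiringHomomorphism : IsSemiringHomomorphism ℕ[t] +-*-rawSemiring sum
  sum-isSemiringHomomorphism = record
    { isNearSemiringHomomorphism = record
      { +-isMonoidHomomorphism = record
        { isMagmaHomomorphism = record
          { isRelHomomorphism = record { cong = ≡.cong sum }
          ; homo = λ p q → ≡.trans (sum-trim (addL p q)) (sum-addL p q)
          }
        ; ε-homo = ≡.refl
        }
      ; *-homo = λ p q → ≡.trans (sum-trim (mulL p q)) (sum-mulL p q)
      }
    ; 1#-homo = ≡.refl
    }

  InT⇒sum-nonZero : ∀ p → InT p → NonZero (sum p)
  InT⇒sum-nonZero p ((q , p≡0∷q) , trim-p≡p) with sum p in eq
  ... | suc _ = _
  ... | zero with () ← ≡.trans (≡.sym p≡0∷q) (≡.trans (≡.sym trim-p≡p) (sum≡0⇒trim≡[] p eq))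

open EvaluationAtOne

module CanonicalMap {c ℓ} (S : Semiring c ℓ) where
  open Semiring S
  open import Algebra.Properties.Semiring.Mult S
  open Eval rawSemiring using (_•_)

  •≈× : ∀ n x → n • x ≈ n × x
  •≈× zero    x = refl
  •≈× (suc n) x = +-congˡ (•≈× n x)

  •≈×1* : ∀ n x → n • x ≈ (n × 1#) * x
  •≈×1* n x = trans (•≈× n x) (trans (×-congʳ n (sym (*-identityˡ x))) (sym (×-assoc-* n 1# x)))

  ×1-isSemiringHomomorphism : IsSemiringHomomorphism +-*-rawSemiring rawSemiring (_× 1#)
  ×1-isSemiringHomomorphism = record
    { isNearSemiringHomomorphism = record
      { +-isMonoidHomomorphism = record
        { isMagmaHomomorphism = record
          { isRelHomomorphism = record { cong = λ { ≡.refl → refl } }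
          ; homo = λ m n → ×-homo-+ 1# m n
          }
        ; ε-homo = refl
        }
      ; *-homo = ×1-homo-*
      }
    ; 1#-homo = ×-homo-1 1#
    }

module _ {a ℓ₁ c ℓ} {S : RawSemiring a ℓ₁} (R : Semiring c ℓ)
         {h : RawSemiring.Carrier S → Semiring.Carrier R}
         (h-homo : IsSemiringHomomorphism S (Semiring.rawSemiring R) h) where
  open Semiring R
  open IsSemiringHomomorphism h-homo
  open RawSemiring S using () renaming (_+_ to _+ₛ_; 0# to 0ₛ)
  private
    module ES = Eval S
    module ER = Eval rawSemiring

  •-homo : ∀ n {x y} → h x ≈ y → h (n ES.• x) ≈ n ER.• y
  •-homo zero    _   = 0#-homo
  •-homo (suc n) hx≈y = trans (+-homo _ _) (+-cong hx≈y (•-homo n hx≈y))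

  ^-homo : ∀ x n → h (x ES.^ n) ≈ h x ER.^ n
  ^-homo x zero    = 1#-homo
  ^-homo x (suc n) = trans (*-homo x (x ES.^ n)) (*-congˡ (^-homo x n))

  prodFin-homo : ∀ n {f g} → (∀ i → h (f i) ≈ g i) →
                 h (ES.prodFin n f) ≈ ER.prodFin n g
  prodFin-homo zero    _    = 1#-homo
  prodFin-homo (suc n) hf≈g =
    trans (*-homo _ _) (*-cong (hf≈g Fin.zero) (prodFin-homo n (hf≈g ∘ Fin.suc)))

  evalMono-homo : ∀ {m} (mon : Monomial m) a → h (ES.evalMono mon a) ≈ ER.evalMono mon (h ∘ a)
  evalMono-homo {m} (k , e) a = •-homo k (prodFin-homo m (λ i → ^-homo (a i) (e i)))

  eval-homo : ∀ {m} (F : GoodPoly m) a → h (ES.eval F a) ≈ ER.eval F (h ∘ a)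
  eval-homo F a = go (monomials F)
    where
    go : ∀ mons → h (foldr (λ mon acc → ES.evalMono mon a +ₛ acc) 0ₛ mons)
                 ≈ foldr (λ mon acc → ER.evalMono mon (h ∘ a) + acc) 0# mons
    go []           = 0#-homo
    go (mon ∷ mons) = trans (+-homo _ _) (+-cong (evalMono-homo mon a) (go mons))

module _ {c ℓ} (R : CommutativeRing c ℓ) where
  open CommutativeRing R
  open import Algebra.Properties.Semiring.Mult semiring using (_×_)
  open CanonicalMap semiring

  characteristicZero⇒×1≉0 : CharacteristicZero R → ∀ n → .{{NonZero n}} → ¬ (n × 1# ≈ 0#)
  characteristicZero⇒×1≉0 char0 (suc n) n×1≈0 with char0 (suc n) (s≤s z≤n)
  ... | x , n•x≉0 = n•x≉0 (trans (•≈×1* (suc n) x) (trans (*-congʳ n×1≈0) (zeroˡ x)))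

  partitionRegular-transfer : ∀ {m k} (F : Fin k → GoodPoly m) {h : List ℕ → Carrier} →
    IsSemiringHomomorphism ℕ[t] (rawSR R) h → (∀ p → InT p → ¬ (h p ≈ 0#)) →
    PartitionRegularT F → PartitionRegularR R F
  partitionRegular-transfer F {h} h-homo h≉0 prT r col col-cong
    with prT r (col ∘ h)
  ... | a , a∈T , Fa∈T , sameColour =
    h ∘ a ,
    (λ i → h≉0 (a i) (a∈T i)) ,
    (λ j → h≉0 _ (Fa∈T j) ∘ trans (h-eval j)) ,
    (λ j j′ → ≡.trans (col-cong _ _ (sym (h-eval j)))
               (≡.trans (sameColour j j′) (col-cong _ _ (h-eval j′))))
    where
    h-eval : ∀ j → h (evalT (F j) a) ≈ Eval.eval (rawSR R) (F j) (h ∘ a)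
    h-eval j = eval-homo semiring h-homo (F j) a

mainTheorem5 : {c ℓ : Level} {m k : ℕ} (F : Fin k → GoodPoly m) →
    PartitionRegularT F →
    (R : CommutativeRing c ℓ) → IsIntegralDomain R → CharacteristicZero R →
    PartitionRegularR R F
mainTheorem5 F prT R _ char0 =
  partitionRegular-transfer R F
    (Composition.isSemiringHomomorphism trans sum-isSemiringHomomorphism
      (×1-isSemiringHomomorphism semiring))
    (λ p p∈T → characteristicZero⇒×1≉0 R char0 (sum p) {{InT⇒sum-nonZero p p∈T}})
    prT
  where open CommutativeRing R using (semiring; trans)
        open CanonicalMap using (×1-isSemiringHomomorphism)
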